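{- Let $P$ be a poset with least element and let $f : P \times P \to P$ be a monotone function. Put $h(x) = \mu_{y}.f(x,y)$. Let $n,m \geq 0$ be such that $h(x) = f_{x}^{m}(\bot)$ for each $x \in P$, where $f_x(y)=f(x,y)$, and $\mu_{x}.h(x) = h^{n}(\bot)$. Then $\mu_{x}.f(x,x) = f^{nm}(\bot,\bot)$, where $f^{k}(\bot,\bot)$ denotes the $k$-th iterate from $\bot$ of the map $x\mapsto f(x,x)$. That is, $\mathrm{cl}(f\circ\Delta)\le \mathrm{cl}(h)\,\mathrm{cl}_y(f)$, where $\Delta(x)=(x,x)$.
   Context: For a monotone $k$ on a poset with least element $\bot$, $\mu.k$ denotes its least (pre)fixed point; the closure ordinal $\mathrm{cl}(k)$ is the least $n$ with $k^{n+1}(\bot)=k^n(\bot)$. $\mathrm{cl}_y(f)\le m$ means $\mathrm{cl}(f_x)\le m$ for every $x\in P$. -}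

module Defs where

open import Level using (Level)
open import Data.Nat using (ℕ; zero; suc)
open import Data.Product using (_×_)
open import Relation.Binary.Bundles using (Poset)

module _ {c ℓ₁ ℓ₂ : Level} (P : Poset c ℓ₁ ℓ₂) where
  open Poset P renaming (Carrier to A)

  IsLeast : A → Set _
  IsLeast b = ∀ x → b ≤ x

  Monotone₂ : (A → A → A) → Set _
  Monotone₂ f = ∀ {x x' y y'} → x ≤ x' → y ≤ y' → f x y ≤ f x' y'

  iter : (A → A) → ℕ → A → A
  iter g zero a = a
  iter g (suc n) a = g (iter g n a)

  IsLeastFixedPoint : (A → A) → A → Set _
  IsLeastFixedPoint k z = (k z ≈ z) × (∀ w → k w ≤ w → z ≤ w)

-- Write g x = f x x. Bekić's diagonal argument shows that μh is also the least fixed point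
-- of g, so every iterate gʲ(⊥) lies below μh. Conversely, if a ≤ gʲ(⊥) then f a reaches at
-- most g^{i+j}(⊥) in i steps; since h a = (f a)ᵐ(⊥), induction gives hᵏ(⊥) ≤ g^{km}(⊥).
-- Hence μh = hⁿ(⊥) ≤ g^{nm}(⊥) ≤ μh.
module Submission where

open import Defs
open import Level using (Level)
open import Data.Nat using (ℕ; _*_; zero; suc; _+_)
open import Data.Product using (_,_; proj₁; proj₂)
open import Relation.Binary.Core using (_Preserves_⟶_)
open import Relation.Binary.Bundles using (Poset)

module Iterates {c ℓ₁ ℓ₂ : Level} (P : Poset c ℓ₁ ℓ₂) where
  open Poset P renaming (Carrier to A)

  monotone⇒≈-preserving : {k : A → A} → k Preserves _≤_ ⟶ _≤_ → k Preserves _≈_ ⟶ _≈_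
  monotone⇒≈-preserving mono x≈y = antisym (mono (reflexive x≈y)) (mono (reflexive (Eq.sym x≈y)))

  lfp-respˡ-≈ : {k : A → A} → k Preserves _≤_ ⟶ _≤_ →
                ∀ {z z'} → IsLeastFixedPoint P k z → z ≈ z' → IsLeastFixedPoint P k z'
  lfp-respˡ-≈ mono (kz≈z , z-least) z≈z' =
      Eq.trans (monotone⇒≈-preserving mono (Eq.sym z≈z')) (Eq.trans kz≈z z≈z')
    , λ w kw≤w → trans (reflexive (Eq.sym z≈z')) (z-least w kw≤w)

  module _ {bot : A} (least : IsLeast P bot) {k : A → A} (mono : k Preserves _≤_ ⟶ _≤_) where

    iter-≤-suc : ∀ j → iter P k j bot ≤ iter P k (suc j) bot
    iter-≤-suc zero    = least _
    iter-≤-suc (suc j) = mono (iter-≤-suc j)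

    iter-≤-+ : ∀ i j → iter P k j bot ≤ iter P k (i + j) bot
    iter-≤-+ zero    j = refl
    iter-≤-+ (suc i) j = trans (iter-≤-+ i j) (iter-≤-suc (i + j))

    iter-≤-prefixed : ∀ {w} → k w ≤ w → ∀ j → iter P k j bot ≤ w
    iter-≤-prefixed kw≤w zero    = least _
    iter-≤-prefixed kw≤w (suc j) = trans (mono (iter-≤-prefixed kw≤w j)) kw≤w

module Diagonal {c ℓ₁ ℓ₂ : Level} (P : Poset c ℓ₁ ℓ₂)
  (f : Poset.Carrier P → Poset.Carrier P → Poset.Carrier P) (mono : Monotone₂ P f) where
  open Poset P renaming (Carrier to A)
  open Iterates P

  diagonal : A → A
  diagonal x = f x x

  diagonal-monotone : diagonal Preserves _≤_ ⟶ _≤_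
  diagonal-monotone x≤y = mono x≤y x≤y

  module _ {h : A → A} (h-lfp : ∀ x → IsLeastFixedPoint P (f x) (h x)) where

    lfp-h⇒lfp-diagonal : ∀ {μ} → IsLeastFixedPoint P h μ → IsLeastFixedPoint P diagonal μ
    lfp-h⇒lfp-diagonal {μ} (hμ≈μ , μ-least) = fμμ≈μ , λ w fww≤w → μ-least w (proj₂ (h-lfp w) w fww≤w)
      where
      fμμ≈μ : f μ μ ≈ μ
      fμμ≈μ = begin-equality
        f μ μ     ≈⟨ monotone⇒≈-preserving (mono refl) (Eq.sym hμ≈μ) ⟩
        f μ (h μ) ≈⟨ proj₁ (h-lfp μ) ⟩
        h μ       ≈⟨ hμ≈μ ⟩
        μ         ∎
        where open import Relation.Binary.Reasoning.PartialOrder P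

    module _ {bot : A} (least : IsLeast P bot) where

      section-iter-≤-diagonal-iter : ∀ {a} j → a ≤ iter P diagonal j bot →
        ∀ i → iter P (f a) i bot ≤ iter P diagonal (i + j) bot
      section-iter-≤-diagonal-iter j a≤ zero    = least _
      section-iter-≤-diagonal-iter j a≤ (suc i) =
        mono (trans a≤ (iter-≤-+ least diagonal-monotone i j)) (section-iter-≤-diagonal-iter j a≤ i)

      iter-h-≤-diagonal-iter : ∀ m → (∀ x → h x ≈ iter P (f x) m bot) →
        ∀ k → iter P h k bot ≤ iter P diagonal (k * m) bot
      iter-h-≤-diagonal-iter m h≈fᵐ zero    = least _
      iter-h-≤-diagonal-iter m h≈fᵐ (suc k) =
        trans (reflexive (h≈fᵐ _))
              (section-iter-≤-diagonal-iter (k * m) (iter-h-≤-diagonal-iter m h≈fᵐ k) m)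

proposition6p5 : ∀ {c ℓ₁ ℓ₂ : Level} (P : Poset c ℓ₁ ℓ₂) (bot : Poset.Carrier P) →
    IsLeast P bot →
    (f : Poset.Carrier P → Poset.Carrier P → Poset.Carrier P) → Monotone₂ P f →
    (h : Poset.Carrier P → Poset.Carrier P) →
    (∀ x → IsLeastFixedPoint P (f x) (h x)) →
    (n m : ℕ) →
    (∀ x → Poset._≈_ P (h x) (iter P (f x) m bot)) →
    (μh : Poset.Carrier P) → IsLeastFixedPoint P h μh →
    Poset._≈_ P μh (iter P h n bot) →
    IsLeastFixedPoint P (λ x → f x x) (iter P (λ x → f x x) (n * m) bot)
proposition6p5 P bot least f mono h h-lfp n m h≈fᵐ μh μh-lfp μh≈hⁿ =
  lfp-respˡ-≈ diagonal-monotone μh-lfp-diagonal μh≈gⁿᵐ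
  where
  open Poset P
  open Iterates P
  open Diagonal P f mono

  μh-lfp-diagonal : IsLeastFixedPoint P diagonal μh
  μh-lfp-diagonal = lfp-h⇒lfp-diagonal h-lfp μh-lfp

  μh≈gⁿᵐ : μh ≈ iter P diagonal (n * m) bot
  μh≈gⁿᵐ = antisym
    (trans (reflexive μh≈hⁿ) (iter-h-≤-diagonal-iter h-lfp least m h≈fᵐ n))
    (iter-≤-prefixed least diagonal-monotone (reflexive (proj₁ μh-lfp-diagonal)) (n * m))
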